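{- Let $y=y_1\cdots y_n$ be an ordinary word (integers), let $t$ be the maximum length of a strictly decreasing subword of $y$, and let $\mathbf k=k_1<\cdots<k_t$ be the place word of the leftmost longest decreasing subword of $y$. If $\mathbf j=j_1<\cdots<j_t$ is any place word such that $y_{j_1}>y_{j_2}>\cdots>y_{j_t}$, then $k_i\le j_i$ for all $i\in[t]$. Similarly, if $\mathbf k$ is the place word of the rightmost longest decreasing subword of $y$, then $k_i\ge j_i$ for all $i\in[t]$ and every such $\mathbf j$.
   Context: $\mathrm{Pos}(y)$ is the poset on $[n]$ in which $i$ is less than $j$ iff $i<j$ and $y_i\le y_j$; its antichains are exactly the place sets of strictly decreasing subwords of $y$, and the maximum-size antichains correspond to the longest decreasing subwords. The set of maximum-size antichains is partially ordered by $A\le B$ iff for each $a\in A$ there is $b\in B$ with $a\le b$ in $\mathrm{Pos}(y)$; by Dilworth this is a distributive lattice, hence has a unique minimum and maximum. The leftmost (resp. rightmost) longest decreasing subword of $y$ is the one corresponding to the minimum (resp. maximum) element. -}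

module Defs where

open import Data.Nat using (ℕ)
open import Data.Fin using (Fin)
import Data.Fin as F
open import Data.Integer using (ℤ)
import Data.Integer as Z
open import Data.Product using (Σ; ∃; _×_)
open import Data.Sum using (_⊎_)
open import Relation.Binary.PropositionalEquality using (_≡_)

Word : ℕ → Set
Word n = Fin n → ℤ

-- A place word j₁ < ⋯ < j_t (length t) is a strictly increasing map Fin t → Fin n.
StrictlyIncreasing : ∀ {n t} → (Fin t → Fin n) → Set
StrictlyIncreasing {t = t} j = ∀ {a b : Fin t} → a F.< b → j a F.< j b

IsDecreasingSubword : ∀ {n t} → Word n → (Fin t → Fin n) → Set
IsDecreasingSubword {t = t} y j =
  StrictlyIncreasing j × (∀ {a b : Fin t} → a F.< b → y (j b) Z.< y (j a))

MaxDecreasingLength : ∀ {n} → Word n → ℕ → Set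
MaxDecreasingLength {n} y t =
  (Σ (Fin t → Fin n) λ j → IsDecreasingSubword y j)
  × (∀ (m : ℕ) (j : Fin m → Fin n) → IsDecreasingSubword y j → m Data.Nat.≤ t)
  where import Data.Nat

IsLongestDecreasing : ∀ {n} → Word n → (t : ℕ) → (Fin t → Fin n) → Set
IsLongestDecreasing y t k = MaxDecreasingLength y t × IsDecreasingSubword y k

PosLe : ∀ {n} → Word n → Fin n → Fin n → Set
PosLe y a b = a ≡ b ⊎ (a F.< b × y a Z.≤ y b)

-- Order on maximum antichains (given by their place words):
-- A ≤ B iff for every a ∈ A there is b ∈ B with a ≤ b in Pos(y).
AntichainLe : ∀ {n t} → Word n → (Fin t → Fin n) → (Fin t → Fin n) → Set
AntichainLe {t = t} y k j = ∀ (a : Fin t) → ∃ λ (b : Fin t) → PosLe y (k a) (j b)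

-- k is the leftmost longest decreasing subword: it corresponds to the
-- minimum element of the lattice of maximum-size antichains.
IsLeftmostLongest : ∀ {n} → Word n → (t : ℕ) → (Fin t → Fin n) → Set
IsLeftmostLongest {n} y t k =
  IsLongestDecreasing y t k
  × (∀ (j : Fin t → Fin n) → IsLongestDecreasing y t j → AntichainLe y k j)

-- k is the rightmost longest decreasing subword: the maximum element.
IsRightmostLongest : ∀ {n} → Word n → (t : ℕ) → (Fin t → Fin n) → Set
IsRightmostLongest {n} y t k =
  IsLongestDecreasing y t k
  × (∀ (j : Fin t → Fin n) → IsLongestDecreasing y t j → AntichainLe y j k)

module Submission where

-- Let t be the maximal length of a strictly decreasing subword
-- of y and let p, q be two decreasing place words of length t.
--   * Crossing lemma: if p i < q i (as places) then y_{p i} ≤ y_{q i}.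
--     Otherwise the splice p₁ ⋯ p_i q_i ⋯ q_t is a decreasing subword of
--     length t + 1, contradicting maximality.
--   * Domination lemma: if p i lies below some q b in Pos(y), then p i ≤ q i.
--     For b ≤ i this is monotonicity of q; for b > i, assuming q i < p i,
--     the crossing lemma gives y_{q i} ≤ y_{p i} ≤ y_{q b} < y_{q i}.
-- The splice is defined for an arbitrary "chain" f (a < b ⇒ R (f a) (f b))
-- in a transitive relation R, so that one argument covers both the places
-- (R = <) and the letters (R = >) of a decreasing subword.  The theorem
-- follows by applying the domination lemma to (k, j) for the leftmost and
-- to (j, k) for the rightmost longest decreasing subword, using the
-- defining property AntichainLe of the minimum / maximum antichain.

open import Defs
open import Data.Nat using (ℕ)
open import Data.Fin using (Fin; _≤_)
open import Data.Product using (_×_)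

open import Level using (Level)
open import Data.Product using (_,_)
open import Data.Sum using (_⊎_; inj₁; inj₂; [_,_])
open import Function using (_∘′_)
open import Data.Vec.Functional using (tail)
import Data.Nat as N
import Data.Nat.Properties as NP
import Data.Fin as F
import Data.Fin.Properties as FP
import Data.Integer as Z
import Data.Integer.Properties as ZP
open import Relation.Nullary using (yes; no; contradiction)
open import Relation.Binary.Core using (Rel)
open import Relation.Binary.Definitions using (Transitive)
open import Relation.Binary.PropositionalEquality using (_≡_; refl; cong; subst₂)

private
  variable
    ℓ ℓ′ : Level
    X : Set ℓ
    n t : ℕ

-- f : Fin t → X is a chain in R when it maps the order of positions into R.
-- A decreasing subword is a chain for < on places and for > on letters.
Chain : Rel X ℓ′ → (Fin t → X) → Set ℓ′
Chain {t = t} R f = ∀ {a b : Fin t} → a F.< b → R (f a) (f b)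

chain-mono : (R : Rel X ℓ′) {f : Fin t → X} → Chain R f →
             ∀ {a b} → a ≤ b → f a ≡ f b ⊎ R (f a) (f b)
chain-mono R {f} chain a≤b with NP.m≤n⇒m<n∨m≡n a≤b
... | inj₁ a<b = inj₂ (chain a<b)
... | inj₂ a≡b = inj₁ (cong f (FP.toℕ-injective a≡b))

-- The splice of p and q at i: the sequence p₀ ⋯ p_i q_i ⋯ q_{t-1},
-- one entry longer than p and q.
splice : Fin t → (Fin t → X) → (Fin t → X) → Fin (N.suc t) → X
splice F.zero    p q F.zero    = p F.zero
splice F.zero    p q (F.suc a) = q a
splice (F.suc i) p q F.zero    = p F.zero
splice (F.suc i) p q (F.suc a) = splice i (tail p) (tail q) a

data SpliceEntry (i : Fin t) (p q : Fin t → X) (a : Fin (N.suc t)) : X → Set where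
  left  : ∀ a′ → F.toℕ a ≡ F.toℕ a′ → a′ ≤ i → SpliceEntry i p q a (p a′)
  right : ∀ a′ → F.toℕ a ≡ N.suc (F.toℕ a′) → i ≤ a′ → SpliceEntry i p q a (q a′)

spliceEntry : ∀ (i : Fin t) (p q : Fin t → X) a → SpliceEntry i p q a (splice i p q a)
spliceEntry F.zero    p q F.zero    = left F.zero refl N.z≤n
spliceEntry F.zero    p q (F.suc a) = right a refl N.z≤n
spliceEntry (F.suc i) p q F.zero    = left F.zero refl N.z≤n
spliceEntry (F.suc i) p q (F.suc a) = shift (spliceEntry i (tail p) (tail q) a)
  where
  shift : ∀ {x} → SpliceEntry i (tail p) (tail q) a x → SpliceEntry (F.suc i) p q (F.suc a) x
  shift (left  a′ a≡a′ a′≤i)    = left  (F.suc a′) (cong N.suc a≡a′) (N.s≤s a′≤i)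
  shift (right a′ a≡1+a′ i≤a′) = right (F.suc a′) (cong N.suc a≡1+a′) (N.s≤s i≤a′)

splice-chain : (R : Rel X ℓ′) → Transitive R → {p q : Fin t → X} →
               Chain R p → Chain R q → ∀ i → R (p i) (q i) → Chain R (splice i p q)
splice-chain R trans {p} {q} chain-p chain-q i pRq {a} {b} a<b =
  entries (spliceEntry i p q a) (spliceEntry i p q b)
  where
  -- From p a′ (weakly) to p i, across to q i, and (weakly) on to q b′.
  through : ∀ {x u v z} → x ≡ u ⊎ R x u → R u v → v ≡ z ⊎ R v z → R x z
  through (inj₁ refl) uRv (inj₁ refl) = uRv
  through (inj₁ refl) uRv (inj₂ vRz)  = trans uRv vRz
  through (inj₂ xRu)  uRv (inj₁ refl) = trans xRu uRv
  through (inj₂ xRu)  uRv (inj₂ vRz)  = trans xRu (trans uRv vRz)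

  entries : ∀ {x z} → SpliceEntry i p q a x → SpliceEntry i p q b z → R x z
  entries (left _ ea _) (left _ eb _) = chain-p (subst₂ N._<_ ea eb a<b)
  entries (right _ ea _) (right _ eb _) = chain-q (NP.≤-pred (subst₂ N._<_ ea eb a<b))
  entries (left _ _ a′≤i) (right _ _ i≤b′) =
    through (chain-mono R chain-p a′≤i) pRq (chain-mono R chain-q i≤b′)
  entries (right _ ea i≤a′) (left _ eb b′≤i) =
    contradiction (subst₂ N._<_ ea eb a<b)
                  (NP.≤⇒≯ (NP.≤-trans (NP.≤-trans b′≤i i≤a′) (NP.n≤1+n _)))

-- Places compared by their letters in y, reversed: a decreasing subword is a
-- chain for this relation.
LetterAbove : Word n → Rel (Fin n) _
LetterAbove y u v = y v Z.< y u

letterAbove-trans : (y : Word n) → Transitive (LetterAbove y)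
letterAbove-trans y u>v v>w = ZP.<-trans v>w u>v

crossing : ∀ (y : Word n) {p q : Fin t → Fin n} → MaxDecreasingLength y t →
           IsDecreasingSubword y p → IsDecreasingSubword y q →
           ∀ i → p i F.< q i → y (p i) Z.≤ y (q i)
crossing y {p} {q} (_ , maximal) (p↑ , p↓) (q↑ , q↓) i pi<qi
  with y (p i) Z.≤? y (q i)
... | yes ypi≤yqi = ypi≤yqi
... | no  ypi≰yqi = contradiction (maximal _ (splice i p q) longer) (NP.<-irrefl refl)
  where
  longer : IsDecreasingSubword y (splice i p q)
  longer = splice-chain F._<_ FP.<-trans p↑ q↑ i pi<qi
         , splice-chain (LetterAbove y) (letterAbove-trans y) p↓ q↓ i (ZP.≰⇒> ypi≰yqi)

posLe-sound : ∀ (y : Word n) {u v} → PosLe y u v → u ≤ v × y u Z.≤ y v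
posLe-sound y (inj₁ refl) = NP.≤-refl , ZP.≤-refl
posLe-sound y (inj₂ (u<v , yu≤yv)) = NP.<⇒≤ u<v , yu≤yv

dominated : ∀ (y : Word n) {p q : Fin t → Fin n} → MaxDecreasingLength y t →
            IsDecreasingSubword y p → IsDecreasingSubword y q →
            ∀ i b → PosLe y (p i) (q b) → p i ≤ q i
dominated y {p} {q} maximal dp (q↑ , q↓) i b pi⊑qb
  with posLe-sound y pi⊑qb | b F.≤? i
... | pi≤qb , _ | yes b≤i =
  NP.≤-trans pi≤qb ([ NP.≤-reflexive ∘′ cong F.toℕ , NP.<⇒≤ ] (chain-mono F._<_ {q} q↑ b≤i))
... | _ , ypi≤yqb | no b≰i with p i F.≤? q i
...   | yes pi≤qi = pi≤qi
...   | no  pi≰qi =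
  contradiction (ZP.≤-<-trans yqi≤ypi (ZP.≤-<-trans ypi≤yqb (q↓ (NP.≰⇒> b≰i))))
                (ZP.<-irrefl refl)
  where
  yqi≤ypi : y (q i) Z.≤ y (p i)
  yqi≤ypi = crossing y maximal (q↑ , q↓) dp i (NP.≰⇒> pi≰qi)

proposition4p3 : (∀ (n : ℕ) (y : Word n) (t : ℕ) (k : Fin t → Fin n) → IsLeftmostLongest y t k →
    ∀ (j : Fin t → Fin n) → IsDecreasingSubword y j → ∀ (i : Fin t) → k i ≤ j i)
    × (∀ (n : ℕ) (y : Word n) (t : ℕ) (k : Fin t → Fin n) → IsRightmostLongest y t k →
    ∀ (j : Fin t → Fin n) → IsDecreasingSubword y j → ∀ (i : Fin t) → j i ≤ k i)
proposition4p3 = leftmost , rightmost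
  where
  leftmost : ∀ n (y : Word n) t k → IsLeftmostLongest y t k →
             ∀ j → IsDecreasingSubword y j → ∀ i → k i ≤ j i
  leftmost n y t k ((maximal , dk) , least) j dj i =
    let (b , ki⊑jb) = least j (maximal , dj) i in dominated y maximal dk dj i b ki⊑jb
  rightmost : ∀ n (y : Word n) t k → IsRightmostLongest y t k →
              ∀ j → IsDecreasingSubword y j → ∀ i → j i ≤ k i
  rightmost n y t k ((maximal , dk) , greatest) j dj i =
    let (b , ji⊑kb) = greatest j (maximal , dj) i in dominated y maximal dj dk i b ji⊑kb
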